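{- Let $k\in\mathbb{N}$, let $P=x_1,x_2,\dots,x_{2k+1}$ be a path, and let $L$ be an $m$-assignment for $P$ with $m\ge 3$. For $c\in L(x_1)$, $d\in L(x_{2k+1})$ let $N(c,d)$ be the number of proper colorings $f$ of $P$ with $f(x)\in L(x)$ for all $x$, $f(x_1)=c$, $f(x_{2k+1})=d$. Then for every $(c,d)\in L(x_1)\times L(x_{2k+1})$, \[\frac{(m-1)^{2k+1}-(m-1)}{m(m-1)}\le N(c,d).\] Furthermore, there exist at least $m$ pairs $(y,z)\in L(x_1)\times L(x_{2k+1})$ such that \[\frac{(m-1)^{2k}+(m-1)}{m}\le N(y,z).\]
   Context: An $m$-assignment $L$ assigns to each vertex a set of $m$ colors. -}

module Defs where

open import Data.Nat using (ℕ; zero; suc; _≡ᵇ_)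
open import Data.Bool using (Bool; true; false; not; _∧_)
open import Data.Fin using (Fin; zero; suc)
open import Data.List using (List; []; _∷_; [_]; map; concatMap; length; filterᵇ)
open import Data.List.Relation.Unary.Unique.Propositional using (Unique)
open import Data.Vec using (Vec; []; _∷_; head; last)
open import Data.Product using (_×_)
open import Relation.Binary.PropositionalEquality using (_≡_)

-- A list assignment on the vertices x_1,…,x_n of a path, vertex x_{i+1} ↦ Fin index i.
-- Colours are natural numbers; each list L i represents the colour set L(x_{i+1}).

IsMAssignment : {n : ℕ} → ℕ → (Fin n → List ℕ) → Set
IsMAssignment {n} m L = (i : Fin n) → Unique (L i) × length (L i) ≡ m

choices : {n : ℕ} → (Fin n → List ℕ) → List (Vec ℕ n)
choices {zero}  L = [ [] ]
choices {suc n} L = concatMap (λ c → map (c ∷_) (choices (λ i → L (suc i)))) (L zero)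

properPath : {n : ℕ} → Vec ℕ n → Bool
properPath []           = true
properPath (x ∷ [])     = true
properPath (x ∷ y ∷ v)  = not (x ≡ᵇ y) ∧ properPath (y ∷ v)

N : {n : ℕ} → (Fin (suc n) → List ℕ) → ℕ → ℕ → ℕ
N L c d = length (filterᵇ (λ f → properPath f ∧ (head f ≡ᵇ c) ∧ (last f ≡ᵇ d)) (choices L))

{-# OPTIONS --safe #-}
module Submission where

-- Write a = m − 1. For a colour x let w_j(x) count the proper list colourings of a path of j
-- further vertices attached to a vertex coloured x and ending in d, so that
-- w_{j+1}(x) = Σ_{y ∈ L, y ≠ x} w_j(y) and N(c,d) ≥ w_{2k}(c); summing over the first colour
-- gives at least a^j colourings. For even j, m w_j(x) ≥ a^j − 1: two steps of the recursion give
-- w_{j+2}(x) = Σ_z c(z) w_j(z) with c(z) = #{y : y ≠ x, y ≠ z} ≥ m − 2 and Σ_z c(z) ≥ a², and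
-- expanding Σ_z (c(z) − (m − 2)) (m w_j(z) − (a^j − 1)) ≥ 0 yields m w_{j+2}(x) ≥ a^{j+2} − 1.
-- Multiplying by a gives the first bound. For the second, a^{2k} = 1 + m r, so the a^{2k}
-- colourings ending in d cannot all come from first colours c with w_{2k}(c) ≤ r; a colour with
-- w_{2k}(c) ≥ r + 1 has m N(c,d) ≥ a^{2k} + a, and the m choices of d give m distinct pairs.

open import Defs
open import Data.Bool using (Bool; true; false; not; _∧_; T)
open import Data.Bool.Properties using (∧-assoc)
open import Data.Fin using (Fin; zero; suc; fromℕ)
open import Data.Fin.Patterns using (0F; 1F; 2F)
open import Data.List using (List; []; _∷_; length; map; concatMap; filterᵇ; _++_)
open import Data.List.Properties using (length-map)
open import Data.List.Membership.Propositional using (_∈_; find)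
open import Data.List.Relation.Unary.All as All using (All; []; _∷_)
open import Data.List.Relation.Unary.All.Properties using (¬Any⇒All¬)
open import Data.List.Relation.Unary.AllPairs using ([]; _∷_)
open import Data.List.Relation.Unary.Any using (here; there; any?)
open import Data.List.Relation.Unary.Unique.Propositional using (Unique)
open import Data.List.Relation.Unary.Unique.Propositional.Properties using (map⁻)
open import Data.Nat using (ℕ; zero; suc; _+_; _*_; _∸_; _^_; _≤_; _<_; _≡ᵇ_; z≤n; s≤s; _<?_)
open import Data.Nat.Properties
open import Data.Nat.Tactic.RingSolver using (solve-∀)
open import Data.Product using (Σ; ∃; _×_; _,_; proj₁; proj₂)
open import Data.Unit using (tt)
open import Data.Vec using (Vec; _∷_; head; last)
open import Function using (_∘_)
open import Relation.Binary.PropositionalEquality using (_≡_; _≢_; refl; sym; trans; cong; cong₂; subst)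
open import Relation.Nullary using (yes; no; contradiction)

open ≤-Reasoning

𝟙 : Bool → ℕ
𝟙 true  = 1
𝟙 false = 0

𝟙-∧ : ∀ p q → 𝟙 (p ∧ q) ≡ 𝟙 p * 𝟙 q
𝟙-∧ true  q = sym (+-identityʳ (𝟙 q))
𝟙-∧ false q = refl

𝟙-∧-middle : ∀ p q r → 𝟙 (p ∧ q ∧ r) ≡ 𝟙 q * 𝟙 (p ∧ r)
𝟙-∧-middle true  true  r = sym (+-identityʳ (𝟙 r))
𝟙-∧-middle true  false r = refl
𝟙-∧-middle false q     r = sym (*-zeroʳ (𝟙 q))

1≤𝟙+𝟙-not : ∀ p → 1 ≤ 𝟙 p + 𝟙 (not p)
1≤𝟙+𝟙-not true  = s≤s z≤n
1≤𝟙+𝟙-not false = s≤s z≤n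

1≤𝟙+𝟙+𝟙-not*𝟙-not : ∀ p q → 1 ≤ 𝟙 p + 𝟙 q + 𝟙 (not p) * 𝟙 (not q)
1≤𝟙+𝟙+𝟙-not*𝟙-not true  q     = s≤s z≤n
1≤𝟙+𝟙+𝟙-not*𝟙-not false true  = s≤s z≤n
1≤𝟙+𝟙+𝟙-not*𝟙-not false false = s≤s z≤n

_≢ᵇ_ : ℕ → ℕ → Bool
x ≢ᵇ y = not (x ≡ᵇ y)

≡ᵇ-refl : ∀ x → (x ≡ᵇ x) ≡ true
≡ᵇ-refl zero    = refl
≡ᵇ-refl (suc x) = ≡ᵇ-refl x

≡ᵇ-comm : ∀ x y → (x ≡ᵇ y) ≡ (y ≡ᵇ x)
≡ᵇ-comm zero    zero    = refl
≡ᵇ-comm zero    (suc y) = refl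
≡ᵇ-comm (suc x) zero    = refl
≡ᵇ-comm (suc x) (suc y) = ≡ᵇ-comm x y

≢ᵇ-comm : ∀ x y → (x ≢ᵇ y) ≡ (y ≢ᵇ x)
≢ᵇ-comm x y = cong not (≡ᵇ-comm x y)

≡ᵇ-true⇒≡ : ∀ {x y} → (x ≡ᵇ y) ≡ true → x ≡ y
≡ᵇ-true⇒≡ {x} {y} e = ≡ᵇ⇒≡ x y (subst T (sym e) tt)

∑ : {A : Set} → List A → (A → ℕ) → ℕ
∑ []       f = 0
∑ (x ∷ xs) f = f x + ∑ xs f

infix 5 ∑
syntax ∑ xs (λ x → e) = ∑[ x ∈ xs ] e

module _ {A : Set} where

  ∑-cong : (xs : List A) {f g : A → ℕ} → (∀ x → f x ≡ g x) → ∑ xs f ≡ ∑ xs g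
  ∑-cong []       e = refl
  ∑-cong (x ∷ xs) e = cong₂ _+_ (e x) (∑-cong xs e)

  ∑-mono-≤ : (xs : List A) {f g : A → ℕ} → (∀ x → f x ≤ g x) → ∑ xs f ≤ ∑ xs g
  ∑-mono-≤ []       h = z≤n
  ∑-mono-≤ (x ∷ xs) h = +-mono-≤ (h x) (∑-mono-≤ xs h)

  ∑-distrib-+ : (xs : List A) (f g : A → ℕ) → ∑[ x ∈ xs ] (f x + g x) ≡ ∑ xs f + ∑ xs g
  ∑-distrib-+ []       f g = refl
  ∑-distrib-+ (x ∷ xs) f g =
    trans (cong (f x + g x +_) (∑-distrib-+ xs f g)) (+-interchange (f x) (g x) (∑ xs f) (∑ xs g))
    where
    +-interchange : ∀ p q r s → p + q + (r + s) ≡ p + r + (q + s)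
    +-interchange = solve-∀

  *-distribˡ-∑ : (k : ℕ) (xs : List A) (f : A → ℕ) → k * ∑ xs f ≡ ∑[ x ∈ xs ] k * f x
  *-distribˡ-∑ k []       f = *-zeroʳ k
  *-distribˡ-∑ k (x ∷ xs) f =
    trans (*-distribˡ-+ k (f x) (∑ xs f)) (cong (k * f x +_) (*-distribˡ-∑ k xs f))

  *-distribʳ-∑ : (k : ℕ) (xs : List A) (f : A → ℕ) → ∑ xs f * k ≡ ∑[ x ∈ xs ] f x * k
  *-distribʳ-∑ k []       f = refl
  *-distribʳ-∑ k (x ∷ xs) f =
    trans (*-distribʳ-+ k (f x) (∑ xs f)) (cong (f x * k +_) (*-distribʳ-∑ k xs f))

  ∑-const : (xs : List A) (k : ℕ) → ∑ xs (λ _ → k) ≡ k * length xs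
  ∑-const []       k = sym (*-zeroʳ k)
  ∑-const (x ∷ xs) k = trans (cong (k +_) (∑-const xs k)) (sym (*-suc k (length xs)))

  length≡∑1 : (xs : List A) → length xs ≡ ∑ xs (λ _ → 1)
  length≡∑1 xs = sym (trans (∑-const xs 1) (*-identityˡ (length xs)))

  ∑-++ : (xs ys : List A) (f : A → ℕ) → ∑ (xs ++ ys) f ≡ ∑ xs f + ∑ ys f
  ∑-++ []       ys f = refl
  ∑-++ (x ∷ xs) ys f = trans (cong (f x +_) (∑-++ xs ys f)) (sym (+-assoc (f x) _ _))

  ∈⇒≤∑ : {x : A} {xs : List A} (f : A → ℕ) → x ∈ xs → f x ≤ ∑ xs f
  ∈⇒≤∑ {xs = y ∷ xs} f (here refl) = m≤m+n (f y) (∑ xs f)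
  ∈⇒≤∑ {xs = y ∷ xs} f (there x∈) = ≤-trans (∈⇒≤∑ f x∈) (m≤n+m (∑ xs f) (f y))

  ∑-≤-*length : {xs : List A} {f : A → ℕ} {r : ℕ} → All (λ x → f x ≤ r) xs → ∑ xs f ≤ r * length xs
  ∑-≤-*length         []       = z≤n
  ∑-≤-*length {x ∷ xs} {f} {r} (p ∷ ps) =
    subst (f x + ∑ xs f ≤_) (sym (*-suc r (length xs))) (+-mono-≤ p (∑-≤-*length ps))

  pigeonhole : (xs : List A) (f : A → ℕ) (r : ℕ) → r * length xs < ∑ xs f → ∃ λ x → x ∈ xs × r < f x
  pigeonhole xs f r r*n<∑ with any? (λ x → r <? f x) xs
  ... | yes some = find some
  ... | no  none = contradiction (∑-≤-*length (All.map ≮⇒≥ (¬Any⇒All¬ xs none))) (<⇒≱ r*n<∑)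

  length-filterᵇ : (p : A → Bool) (xs : List A) → length (filterᵇ p xs) ≡ ∑[ x ∈ xs ] 𝟙 (p x)
  length-filterᵇ p []       = refl
  length-filterᵇ p (x ∷ xs) with p x
  ... | true  = cong suc (length-filterᵇ p xs)
  ... | false = length-filterᵇ p xs

module _ {A B : Set} where

  ∑-map : (g : A → B) (xs : List A) (f : B → ℕ) → ∑ (map g xs) f ≡ ∑[ x ∈ xs ] f (g x)
  ∑-map g []       f = refl
  ∑-map g (x ∷ xs) f = cong (f (g x) +_) (∑-map g xs f)

  ∑-concatMap : (g : A → List B) (xs : List A) (f : B → ℕ) → ∑ (concatMap g xs) f ≡ ∑[ x ∈ xs ] ∑ (g x) f
  ∑-concatMap g []       f = refl
  ∑-concatMap g (x ∷ xs) f =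
    trans (∑-++ (g x) (concatMap g xs) f) (cong (∑ (g x) f +_) (∑-concatMap g xs f))

  ∑-comm : (xs : List A) (ys : List B) (f : A → B → ℕ) →
           ∑[ x ∈ xs ] ∑[ y ∈ ys ] f x y ≡ ∑[ y ∈ ys ] ∑[ x ∈ xs ] f x y
  ∑-comm []       ys f = sym (∑-const ys 0)
  ∑-comm (x ∷ xs) ys f = trans (cong (∑ ys (f x) +_) (∑-comm xs ys f)) (sym (∑-distrib-+ ys (f x) _))

  partners : {R : A → B → Set} (ys : List B) → (∀ {y} → y ∈ ys → ∃ λ x → R x y) →
             ∃ λ (ps : List (A × B)) → map proj₂ ps ≡ ys × All (λ p → R (proj₁ p) (proj₂ p)) ps
  partners []       choose = [] , refl , []
  partners (y ∷ ys) choose =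
    let x , r          = choose (here refl)
        ps , ps≡ys , rs = partners ys (choose ∘ there)
    in  (x , y) ∷ ps , cong (y ∷_) ps≡ys , r ∷ rs

∉⇒∑≡ᵇ≡0 : {w : ℕ} {ys : List ℕ} → All (w ≢_) ys → ∑[ y ∈ ys ] 𝟙 (w ≡ᵇ y) ≡ 0
∉⇒∑≡ᵇ≡0 []                         = refl
∉⇒∑≡ᵇ≡0 {w} {y ∷ ys} (w≢y ∷ w∉ys) with w ≡ᵇ y in e
... | true  = contradiction (≡ᵇ-true⇒≡ e) w≢y
... | false = ∉⇒∑≡ᵇ≡0 w∉ys

unique⇒∑≡ᵇ≤1 : {ys : List ℕ} → Unique ys → (w : ℕ) → ∑[ y ∈ ys ] 𝟙 (w ≡ᵇ y) ≤ 1
unique⇒∑≡ᵇ≤1 []                  w = z≤n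
unique⇒∑≡ᵇ≤1 {y ∷ ys} (y∉ys ∷ u) w with w ≡ᵇ y in e
... | true with refl ← ≡ᵇ-true⇒≡ {w} {y} e = s≤s (≤-reflexive (∉⇒∑≡ᵇ≡0 y∉ys))
... | false = unique⇒∑≡ᵇ≤1 u w

unique⇒≤∑≢ᵇ : {ys : List ℕ} {n : ℕ} → Unique ys × length ys ≡ suc n →
              (w : ℕ) → n ≤ ∑[ y ∈ ys ] 𝟙 (w ≢ᵇ y)
unique⇒≤∑≢ᵇ {ys} {n} (u , len) w = +-cancelˡ-≤ 1 n _ (begin
  suc n                                                 ≡⟨ sym len ⟩
  length ys                                             ≡⟨ length≡∑1 ys ⟩
  ∑ ys (λ _ → 1)                                        ≤⟨ ∑-mono-≤ ys (λ y → 1≤𝟙+𝟙-not (w ≡ᵇ y)) ⟩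
  ∑[ y ∈ ys ] (𝟙 (w ≡ᵇ y) + 𝟙 (w ≢ᵇ y))                 ≡⟨ ∑-distrib-+ ys _ _ ⟩
  (∑[ y ∈ ys ] 𝟙 (w ≡ᵇ y)) + (∑[ y ∈ ys ] 𝟙 (w ≢ᵇ y))   ≤⟨ +-monoˡ-≤ _ (unique⇒∑≡ᵇ≤1 u w) ⟩
  1 + (∑[ y ∈ ys ] 𝟙 (w ≢ᵇ y))                          ∎)

unique⇒≤∑≢ᵇ*≢ᵇ : {ys : List ℕ} {n : ℕ} → Unique ys × length ys ≡ 2 + n →
                 (v w : ℕ) → n ≤ ∑[ y ∈ ys ] 𝟙 (v ≢ᵇ y) * 𝟙 (w ≢ᵇ y)
unique⇒≤∑≢ᵇ*≢ᵇ {ys} {n} (u , len) v w = +-cancelˡ-≤ 2 n _ (begin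
  2 + n                                        ≡⟨ sym len ⟩
  length ys                                    ≡⟨ length≡∑1 ys ⟩
  ∑ ys (λ _ → 1)                               ≤⟨ ∑-mono-≤ ys (λ y → 1≤𝟙+𝟙+𝟙-not*𝟙-not (v ≡ᵇ y) (w ≡ᵇ y)) ⟩
  ∑[ y ∈ ys ] (𝟙 (v ≡ᵇ y) + 𝟙 (w ≡ᵇ y) + 𝟙 (v ≢ᵇ y) * 𝟙 (w ≢ᵇ y))
    ≡⟨ trans (∑-distrib-+ ys _ _) (cong (_+ (∑[ y ∈ ys ] 𝟙 (v ≢ᵇ y) * 𝟙 (w ≢ᵇ y))) (∑-distrib-+ ys _ _)) ⟩
  (∑[ y ∈ ys ] 𝟙 (v ≡ᵇ y)) + (∑[ y ∈ ys ] 𝟙 (w ≡ᵇ y)) + (∑[ y ∈ ys ] 𝟙 (v ≢ᵇ y) * 𝟙 (w ≢ᵇ y))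
    ≤⟨ +-monoˡ-≤ _ (+-mono-≤ (unique⇒∑≡ᵇ≤1 u v) (unique⇒∑≡ᵇ≤1 u w)) ⟩
  2 + (∑[ y ∈ ys ] 𝟙 (v ≢ᵇ y) * 𝟙 (w ≢ᵇ y))    ∎)

-- (γ ∸ b) * (α ∸ ℓ) ≥ 0, expanded.
cross-≤ : {α γ : ℕ} (ℓ b : ℕ) → ℓ ≤ α → b ≤ γ → b * α + ℓ * γ ≤ γ * α + b * ℓ
cross-≤ ℓ b ℓ≤α b≤γ with m≤n⇒∃[o]m+o≡n ℓ≤α | m≤n⇒∃[o]m+o≡n b≤γ
... | u , refl | v , refl = begin
  b * (ℓ + u) + ℓ * (b + v)           ≤⟨ m≤m+n _ (v * u) ⟩
  b * (ℓ + u) + ℓ * (b + v) + v * u   ≡⟨ expand b ℓ u v ⟩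
  (b + v) * (ℓ + u) + b * ℓ           ∎
  where
  expand : ∀ b ℓ u v → b * (ℓ + u) + ℓ * (b + v) + v * u ≡ (b + v) * (ℓ + u) + b * ℓ
  expand = solve-∀

∑-cross-≤ : {A : Set} (zs : List A) (α γ : A → ℕ) (ℓ b : ℕ) → (∀ z → ℓ ≤ α z) → (∀ z → b ≤ γ z) →
            b * ∑ zs α + ℓ * ∑ zs γ ≤ (∑[ z ∈ zs ] γ z * α z) + b * ℓ * length zs
∑-cross-≤ zs α γ ℓ b ℓ≤α b≤γ = begin
  b * ∑ zs α + ℓ * ∑ zs γ                          ≡⟨ cong₂ _+_ (*-distribˡ-∑ b zs α) (*-distribˡ-∑ ℓ zs γ) ⟩
  (∑[ z ∈ zs ] b * α z) + (∑[ z ∈ zs ] ℓ * γ z)    ≡⟨ ∑-distrib-+ zs _ _ ⟨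
  ∑[ z ∈ zs ] (b * α z + ℓ * γ z)                  ≤⟨ ∑-mono-≤ zs (λ z → cross-≤ ℓ b (ℓ≤α z) (b≤γ z)) ⟩
  ∑[ z ∈ zs ] (γ z * α z + b * ℓ)                  ≡⟨ ∑-distrib-+ zs _ _ ⟩
  (∑[ z ∈ zs ] γ z * α z) + ∑ zs (λ _ → b * ℓ)     ≡⟨ cong (_ +_) (∑-const zs (b * ℓ)) ⟩
  (∑[ z ∈ zs ] γ z * α z) + b * ℓ * length zs      ∎

∑-weighted-lower-bound : {A : Set} {b ℓ : ℕ} (zs : List A) (W c : A → ℕ) → length zs ≡ 2 + b →
  (∀ z → ℓ ≤ (2 + b) * W z) → (∀ z → b ≤ c z) → suc ℓ ≤ ∑ zs W → suc b * suc b ≤ ∑ zs c →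
  suc b * (suc b * suc ℓ) ≤ 1 + (2 + b) * (∑[ z ∈ zs ] c z * W z)
∑-weighted-lower-bound {b = b} {ℓ} zs W c len ℓ≤mW b≤c 1+ℓ≤∑W a*a≤∑c = +-cancelʳ-≤ (b * ℓ * m) _ _ (begin
  a * (a * suc ℓ) + b * ℓ * m                        ≡⟨ expand b ℓ ⟩
  1 + (b * (m * suc ℓ) + ℓ * (a * a))
    ≤⟨ s≤s (+-mono-≤ (*-monoʳ-≤ b (*-monoʳ-≤ m 1+ℓ≤∑W)) (*-monoʳ-≤ ℓ a*a≤∑c)) ⟩
  1 + (b * (m * ∑ zs W) + ℓ * ∑ zs c)                ≡⟨ cong (λ t → 1 + (b * t + ℓ * ∑ zs c)) (*-distribˡ-∑ m zs W) ⟩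
  1 + (b * (∑[ z ∈ zs ] m * W z) + ℓ * ∑ zs c)       ≤⟨ s≤s (∑-cross-≤ zs (λ z → m * W z) c ℓ b ℓ≤mW b≤c) ⟩
  1 + ((∑[ z ∈ zs ] c z * (m * W z)) + b * ℓ * length zs)
    ≡⟨ cong₂ (λ s l → 1 + (s + b * ℓ * l)) (sym m*∑≡∑*) len ⟩
  1 + m * (∑[ z ∈ zs ] c z * W z) + b * ℓ * m        ∎)
  where
  a m : ℕ
  a = suc b
  m = 2 + b
  expand : ∀ b ℓ → suc b * (suc b * suc ℓ) + b * ℓ * (2 + b) ≡ 1 + (b * ((2 + b) * suc ℓ) + ℓ * (suc b * suc b))
  expand = solve-∀
  m*∑≡∑* : m * (∑[ z ∈ zs ] c z * W z) ≡ ∑[ z ∈ zs ] c z * (m * W z)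
  m*∑≡∑* = trans (*-distribˡ-∑ m zs _) (∑-cong zs (λ z → x*[y*z]≡y*[x*z] m (c z) (W z)))
    where
    x*[y*z]≡y*[x*z] : ∀ x y z → x * (y * z) ≡ y * (x * z)
    x*[y*z]≡y*[x*z] = solve-∀

data Even : ℕ → Set where
  even-zero    : Even 0
  even-suc-suc : {j : ℕ} → Even j → Even (suc (suc j))

even-2* : (k : ℕ) → Even (2 * k)
even-2* zero    = even-zero
even-2* (suc k) = subst Even (cong suc (sym (+-suc k (k + 0)))) (even-suc-suc (even-2* k))

-- The witness comes from (m − 1)² = 1 + m (m − 2).
pred^even≡1+m* : {b j : ℕ} → Even j → ∃ λ r → suc b ^ j ≡ 1 + (2 + b) * r
pred^even≡1+m* {b} even-zero = 0 , cong suc (sym (*-zeroʳ (2 + b)))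
pred^even≡1+m* {b} {suc (suc j)} (even-suc-suc e) =
  let r , a^j≡ = pred^even≡1+m* {b} e
  in  b + suc b * suc b * r , trans (cong (λ t → suc b * (suc b * t)) a^j≡) (expand b r)
  where
  expand : ∀ b r → suc b * (suc b * (1 + (2 + b) * r)) ≡ 1 + (2 + b) * (b + suc b * suc b * r)
  expand = solve-∀

^-+1∸≤ : {a m n : ℕ} (j : ℕ) → a ^ j ≤ 1 + m * n → a ^ (j + 1) ∸ a ≤ (m * a) * n
^-+1∸≤ {a} {m} {n} j a^j≤ = begin
  a ^ (j + 1) ∸ a           ≡⟨ cong (λ t → a ^ t ∸ a) (+-comm j 1) ⟩
  a * a ^ j ∸ a             ≤⟨ ∸-monoˡ-≤ a (*-monoʳ-≤ a a^j≤) ⟩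
  a * (1 + m * n) ∸ a       ≡⟨ cong (_∸ a) (expand a m n) ⟩
  a + (m * a) * n ∸ a       ≡⟨ m+n∸m≡n a _ ⟩
  (m * a) * n               ∎
  where
  expand : ∀ a m n → a * (1 + m * n) ≡ a + (m * a) * n
  expand = solve-∀

∑-choices : {j : ℕ} (M : Fin (suc j) → List ℕ) (F : Vec ℕ (suc j) → ℕ) →
            ∑ (choices M) F ≡ ∑[ y ∈ M zero ] ∑[ g ∈ choices (M ∘ suc) ] F (y ∷ g)
∑-choices M F =
  trans (∑-concatMap _ (M zero) F) (∑-cong (M zero) (λ y → ∑-map (y ∷_) (choices (M ∘ suc)) F))

module _ (d : ℕ) where

  walks : {j : ℕ} → (Fin j → List ℕ) → ℕ → ℕ
  walks {zero}  M x = 𝟙 (x ≡ᵇ d)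
  walks {suc j} M x = ∑[ y ∈ M zero ] 𝟙 (x ≢ᵇ y) * walks (M ∘ suc) y

  walks-count : {j : ℕ} (M : Fin j → List ℕ) (x : ℕ) →
                ∑[ g ∈ choices M ] 𝟙 (properPath (x ∷ g) ∧ (last (x ∷ g) ≡ᵇ d)) ≡ walks M x
  walks-count {zero}  M x = +-identityʳ (𝟙 (x ≡ᵇ d))
  walks-count {suc j} M x = trans (∑-choices M _) (∑-cong (M zero) through)
    where
    through : ∀ y → ∑[ g ∈ choices (M ∘ suc) ] 𝟙 ((x ≢ᵇ y ∧ properPath (y ∷ g)) ∧ (last (y ∷ g) ≡ᵇ d))
                    ≡ 𝟙 (x ≢ᵇ y) * walks (M ∘ suc) y
    through y = begin-equality
      ∑[ g ∈ choices (M ∘ suc) ] 𝟙 ((x ≢ᵇ y ∧ properPath (y ∷ g)) ∧ (last (y ∷ g) ≡ᵇ d))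
        ≡⟨ ∑-cong (choices (M ∘ suc)) (λ g → trans (cong 𝟙 (∧-assoc (x ≢ᵇ y) _ _)) (𝟙-∧ (x ≢ᵇ y) _)) ⟩
      ∑[ g ∈ choices (M ∘ suc) ] 𝟙 (x ≢ᵇ y) * 𝟙 (properPath (y ∷ g) ∧ (last (y ∷ g) ≡ᵇ d))
        ≡⟨ *-distribˡ-∑ (𝟙 (x ≢ᵇ y)) (choices (M ∘ suc)) _ ⟨
      𝟙 (x ≢ᵇ y) * (∑[ g ∈ choices (M ∘ suc) ] 𝟙 (properPath (y ∷ g) ∧ (last (y ∷ g) ≡ᵇ d)))
        ≡⟨ cong (𝟙 (x ≢ᵇ y) *_) (walks-count (M ∘ suc) y) ⟩
      𝟙 (x ≢ᵇ y) * walks (M ∘ suc) y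
        ∎

  N≡∑walks : {j : ℕ} (L : Fin (suc j) → List ℕ) (c : ℕ) →
             N L c d ≡ ∑[ y ∈ L zero ] 𝟙 (y ≡ᵇ c) * walks (L ∘ suc) y
  N≡∑walks L c = begin-equality
    N L c d
      ≡⟨ length-filterᵇ _ (choices L) ⟩
    ∑ (choices L) (λ f → 𝟙 (properPath f ∧ (head f ≡ᵇ c) ∧ (last f ≡ᵇ d)))
      ≡⟨ ∑-choices L _ ⟩
    ∑[ y ∈ L zero ] ∑[ g ∈ choices (L ∘ suc) ] 𝟙 (properPath (y ∷ g) ∧ (y ≡ᵇ c) ∧ (last (y ∷ g) ≡ᵇ d))
      ≡⟨ ∑-cong (L zero) (λ y → trans (∑-cong (choices (L ∘ suc)) (λ g → 𝟙-∧-middle (properPath (y ∷ g)) (y ≡ᵇ c) _))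
                                       (sym (*-distribˡ-∑ (𝟙 (y ≡ᵇ c)) (choices (L ∘ suc)) _))) ⟩
    ∑[ y ∈ L zero ] 𝟙 (y ≡ᵇ c) * (∑[ g ∈ choices (L ∘ suc) ] 𝟙 (properPath (y ∷ g) ∧ (last (y ∷ g) ≡ᵇ d)))
      ≡⟨ ∑-cong (L zero) (λ y → cong (𝟙 (y ≡ᵇ c) *_) (walks-count (L ∘ suc) y)) ⟩
    ∑[ y ∈ L zero ] 𝟙 (y ≡ᵇ c) * walks (L ∘ suc) y
      ∎

  walks≤N : {j : ℕ} (L : Fin (suc j) → List ℕ) {c : ℕ} → c ∈ L zero → walks (L ∘ suc) c ≤ N L c d
  walks≤N L {c} c∈ = begin
    walks (L ∘ suc) c                                  ≡⟨ +-identityʳ _ ⟨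
    𝟙 true * walks (L ∘ suc) c                         ≡⟨ cong (λ t → 𝟙 t * walks (L ∘ suc) c) (≡ᵇ-refl c) ⟨
    𝟙 (c ≡ᵇ c) * walks (L ∘ suc) c                     ≤⟨ ∈⇒≤∑ (λ y → 𝟙 (y ≡ᵇ c) * walks (L ∘ suc) y) c∈ ⟩
    ∑[ y ∈ L zero ] 𝟙 (y ≡ᵇ c) * walks (L ∘ suc) y     ≡⟨ N≡∑walks L c ⟨
    N L c d                                            ∎

  ∑-*-walks : {j : ℕ} (xs : List ℕ) (w : ℕ → ℕ) (M : Fin (suc j) → List ℕ) →
              ∑[ y ∈ xs ] w y * walks M y
              ≡ ∑[ z ∈ M zero ] (∑[ y ∈ xs ] w y * 𝟙 (y ≢ᵇ z)) * walks (M ∘ suc) z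
  ∑-*-walks xs w M = begin-equality
    ∑[ y ∈ xs ] w y * (∑[ z ∈ M zero ] 𝟙 (y ≢ᵇ z) * walks (M ∘ suc) z)
      ≡⟨ ∑-cong xs (λ y → *-distribˡ-∑ (w y) (M zero) _) ⟩
    ∑[ y ∈ xs ] ∑[ z ∈ M zero ] w y * (𝟙 (y ≢ᵇ z) * walks (M ∘ suc) z)
      ≡⟨ ∑-comm xs (M zero) _ ⟩
    ∑[ z ∈ M zero ] ∑[ y ∈ xs ] w y * (𝟙 (y ≢ᵇ z) * walks (M ∘ suc) z)
      ≡⟨ ∑-cong (M zero) (λ z → trans (∑-cong xs (λ y → sym (*-assoc (w y) _ _))) (sym (*-distribʳ-∑ _ xs _))) ⟩
    ∑[ z ∈ M zero ] (∑[ y ∈ xs ] w y * 𝟙 (y ≢ᵇ z)) * walks (M ∘ suc) z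
      ∎

  pow≤∑walks : {a j : ℕ} (M : Fin (suc j) → List ℕ) → IsMAssignment (suc a) M → d ∈ M (fromℕ j) →
               a ^ j ≤ ∑[ y ∈ M zero ] walks (M ∘ suc) y
  pow≤∑walks {j = zero} M hM d∈ =
    subst (λ t → 𝟙 t ≤ ∑[ y ∈ M zero ] 𝟙 (y ≡ᵇ d)) (≡ᵇ-refl d) (∈⇒≤∑ (λ y → 𝟙 (y ≡ᵇ d)) d∈)
  pow≤∑walks {a} {suc j} M hM d∈ = begin
    a * a ^ j                                                   ≤⟨ *-monoʳ-≤ a (pow≤∑walks (M ∘ suc) (hM ∘ suc) d∈) ⟩
    a * (∑[ z ∈ M 1F ] W z)                                     ≡⟨ *-distribˡ-∑ a (M 1F) W ⟩
    ∑[ z ∈ M 1F ] a * W z                                       ≤⟨ ∑-mono-≤ (M 1F) (λ z → *-monoˡ-≤ (W z) (others z)) ⟩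
    ∑[ z ∈ M 1F ] (∑[ y ∈ M 0F ] 1 * 𝟙 (y ≢ᵇ z)) * W z          ≡⟨ ∑-*-walks (M 0F) (λ _ → 1) (M ∘ suc) ⟨
    ∑[ y ∈ M 0F ] 1 * walks (M ∘ suc) y                         ≡⟨ ∑-cong (M 0F) (λ y → *-identityˡ _) ⟩
    ∑[ y ∈ M 0F ] walks (M ∘ suc) y                             ∎
    where
    W : ℕ → ℕ
    W = walks {j} (λ i → M (suc (suc i)))
    others : ∀ z → a ≤ ∑[ y ∈ M 0F ] 1 * 𝟙 (y ≢ᵇ z)
    others z = subst (a ≤_) (∑-cong (M 0F) (λ y → trans (cong 𝟙 (≢ᵇ-comm z y)) (sym (*-identityˡ _))))
                     (unique⇒≤∑≢ᵇ (hM 0F) z)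

  -- Stated for the whole path so that the last list is L (fromℕ j).
  pow≤walks-even : {b j : ℕ} → Even j → (L : Fin (suc j) → List ℕ) → IsMAssignment (2 + b) L →
                   d ∈ L (fromℕ j) → (x : ℕ) → suc b ^ j ≤ 1 + (2 + b) * walks (L ∘ suc) x
  pow≤walks-even even-zero L hL d∈ x = s≤s z≤n
  pow≤walks-even {b} {suc (suc j)} (even-suc-suc e) L hL d∈ x = begin
    a * (a * a ^ j)                          ≡⟨ cong (λ t → a * (a * t)) a^j≡1+ℓ ⟩
    a * (a * suc ℓ)                          ≤⟨ ∑-weighted-lower-bound (L 2F) W c (proj₂ (hL 2F)) ℓ≤mW b≤c 1+ℓ≤∑W a*a≤∑c ⟩
    1 + m * (∑[ z ∈ L 2F ] c z * W z)        ≡⟨ cong (λ t → 1 + m * t) (∑-*-walks (L 1F) (𝟙 ∘ (x ≢ᵇ_)) L″) ⟨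
    1 + m * walks (L ∘ suc) x                ∎
    where
    a m ℓ : ℕ
    a = suc b
    m = 2 + b
    ℓ = a ^ j ∸ 1
    a^j≡1+ℓ : a ^ j ≡ suc ℓ
    a^j≡1+ℓ = sym (m+[n∸m]≡n (m^n>0 a j))
    L″ : Fin (suc j) → List ℕ
    L″ i = L (suc (suc i))
    hL″ : IsMAssignment m L″
    hL″ i = hL (suc (suc i))
    W : ℕ → ℕ
    W = walks (L″ ∘ suc)
    c : ℕ → ℕ
    c z = ∑[ y ∈ L 1F ] 𝟙 (x ≢ᵇ y) * 𝟙 (y ≢ᵇ z)
    ℓ≤mW : ∀ z → ℓ ≤ m * W z
    ℓ≤mW z = ≤-pred (subst (_≤ 1 + m * W z) a^j≡1+ℓ (pow≤walks-even e L″ hL″ d∈ z))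
    1+ℓ≤∑W : suc ℓ ≤ ∑ (L 2F) W
    1+ℓ≤∑W = subst (_≤ ∑ (L 2F) W) a^j≡1+ℓ (pow≤∑walks L″ hL″ d∈)
    b≤c : ∀ z → b ≤ c z
    b≤c z = subst (b ≤_) (∑-cong (L 1F) (λ y → cong (λ t → 𝟙 (x ≢ᵇ y) * 𝟙 t) (≢ᵇ-comm z y)))
                  (unique⇒≤∑≢ᵇ*≢ᵇ (hL 1F) x z)
    a*a≤∑c : a * a ≤ ∑ (L 2F) c
    a*a≤∑c = begin
      a * a                                                       ≤⟨ *-monoˡ-≤ a (unique⇒≤∑≢ᵇ (hL 1F) x) ⟩
      (∑[ y ∈ L 1F ] 𝟙 (x ≢ᵇ y)) * a                              ≡⟨ *-distribʳ-∑ a (L 1F) _ ⟩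
      ∑[ y ∈ L 1F ] 𝟙 (x ≢ᵇ y) * a
        ≤⟨ ∑-mono-≤ (L 1F) (λ y → *-monoʳ-≤ (𝟙 (x ≢ᵇ y)) (unique⇒≤∑≢ᵇ (hL 2F) y)) ⟩
      ∑[ y ∈ L 1F ] 𝟙 (x ≢ᵇ y) * (∑[ z ∈ L 2F ] 𝟙 (y ≢ᵇ z))       ≡⟨ ∑-cong (L 1F) (λ y → *-distribˡ-∑ (𝟙 (x ≢ᵇ y)) (L 2F) _) ⟩
      ∑[ y ∈ L 1F ] ∑[ z ∈ L 2F ] 𝟙 (x ≢ᵇ y) * 𝟙 (y ≢ᵇ z)         ≡⟨ ∑-comm (L 1F) (L 2F) _ ⟩
      ∑ (L 2F) c                                                  ∎

  pow≤N-even : {b j : ℕ} → Even j → (L : Fin (suc j) → List ℕ) → IsMAssignment (2 + b) L →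
               {c : ℕ} → c ∈ L zero → d ∈ L (fromℕ j) → suc b ^ j ≤ 1 + (2 + b) * N L c d
  pow≤N-even {b} e L hL {c} c∈ d∈ =
    ≤-trans (pow≤walks-even e L hL d∈ c) (s≤s (*-monoʳ-≤ (2 + b) (walks≤N L c∈)))

  pow+≤N-even : {b j : ℕ} → Even j → (L : Fin (suc j) → List ℕ) → IsMAssignment (2 + b) L →
                d ∈ L (fromℕ j) → ∃ λ x → x ∈ L zero × suc b ^ j + suc b ≤ (2 + b) * N L x d
  pow+≤N-even {b} {j} e L hL d∈ =
    let r , a^j≡1+mr     = pred^even≡1+m* {b} e
        x , x∈ , r<walks = pigeonhole (L zero) (walks (L ∘ suc)) r (begin-strict
          r * length (L zero)                  ≡⟨ cong (r *_) (proj₂ (hL zero)) ⟩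
          r * m                                ≡⟨ *-comm r m ⟩
          m * r                                <⟨ n<1+n (m * r) ⟩
          1 + m * r                            ≡⟨ a^j≡1+mr ⟨
          a ^ j                                ≤⟨ pow≤∑walks L hL d∈ ⟩
          ∑[ y ∈ L zero ] walks (L ∘ suc) y    ∎)
    in  x , x∈ , (begin
          a ^ j + a                            ≡⟨ cong (_+ a) a^j≡1+mr ⟩
          1 + m * r + a                        ≡⟨ expand b r ⟩
          m * suc r                            ≤⟨ *-monoʳ-≤ m r<walks ⟩
          m * walks (L ∘ suc) x                ≤⟨ *-monoʳ-≤ m (walks≤N L x∈) ⟩
          m * N L x d                          ∎)
    where
    a m : ℕ
    a = suc b
    m = 2 + b
    expand : ∀ b r → 1 + (2 + b) * r + suc b ≡ (2 + b) * suc r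
    expand = solve-∀

pairs-with-large-N : {b j : ℕ} → Even j → (L : Fin (suc j) → List ℕ) → IsMAssignment (2 + b) L →
  Σ (List (ℕ × ℕ)) λ ps → 2 + b ≤ length ps × Unique ps ×
    All (λ p → proj₁ p ∈ L zero × proj₂ p ∈ L (fromℕ j) ×
               suc b ^ j + suc b ≤ (2 + b) * N L (proj₁ p) (proj₂ p)) ps
pairs-with-large-N {b} {j} e L hL
  with partners (L (fromℕ j)) (λ {d} d∈ → let x , x∈ , bound = pow+≤N-even d e L hL d∈ in x , x∈ , d∈ , bound)
... | ps , ps≡last , bounds =
  ps ,
  ≤-reflexive (begin-equality
    2 + b                    ≡⟨ proj₂ (hL (fromℕ j)) ⟨
    length (L (fromℕ j))     ≡⟨ cong length ps≡last ⟨
    length (map proj₂ ps)    ≡⟨ length-map proj₂ ps ⟩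
    length ps                ∎) ,
  map⁻ (subst Unique (sym ps≡last) (proj₁ (hL (fromℕ j)))) ,
  bounds

mainTheorem11 : (k m : ℕ) → 3 ≤ m → (L : Fin (suc (2 * k)) → List ℕ) → IsMAssignment m L →
    ((c d : ℕ) → c ∈ L zero → d ∈ L (fromℕ (2 * k)) →
      (m ∸ 1) ^ (2 * k + 1) ∸ (m ∸ 1) ≤ (m * (m ∸ 1)) * N L c d)
    × Σ (List (ℕ × ℕ)) (λ ps → m ≤ length ps × Unique ps ×
        All (λ p → proj₁ p ∈ L zero × proj₂ p ∈ L (fromℕ (2 * k)) ×
                   (m ∸ 1) ^ (2 * k) + (m ∸ 1) ≤ m * N L (proj₁ p) (proj₂ p)) ps)
mainTheorem11 k (suc (suc b)) (s≤s (s≤s _)) L hL =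
  (λ c d c∈ d∈ → ^-+1∸≤ {m = 2 + b} (2 * k) (pow≤N-even d (even-2* k) L hL c∈ d∈)) ,
  pairs-with-large-N (even-2* k) L hL
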